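{- Let $n\ge 1$ and $x\in\mathbb{R}$. Let $G_n$ be the graph with vertex set $\{(i,j):1\le i,j\le n+1,\ i\ne j\}$ in which $(i,j)$ and $(i',j')$ are adjacent if $|i-i'|+|j-j'|=1$, and additionally $(j,j+1)$ and $(j+1,j)$ are adjacent for each $1\le j\le n$. Define $p^{(0)}_{ij}(x)=1$ for $i<j$ and $0$ for $i>j$, and for $t\ge0$ $$p^{(t+1)}_v(x)=p^{(t)}_v(x)+x\sum_{w\sim v \text{ in } G_n}\left(p^{(t)}_w(x)-p^{(t)}_v(x)\right).$$ Let $E_{nt}(x)=\sum_{1\le j<i\le n+1}p^{(t)}_{ij}(x)$. Then for all $t\ge 0$, $$E_{n\,t+1}(x)=E_{nt}(x)+nx-2x\sum_{j=1}^{n}p^{(t)}_{j+1,j}(x).$$ -}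

module Defs where

open import Level using (Level)
open import Data.Nat as ℕ using (ℕ; zero; suc; ∣_-_∣; _≡ᵇ_; _<ᵇ_)
open import Data.Fin using (Fin; toℕ; inject₁)
  renaming (zero to fzero; suc to fsuc)
open import Data.Bool using (Bool; if_then_else_; _∨_; _∧_; not)
open import Algebra.Bundles using (CommutativeRing)

-- Vertices of G_n, 0-based: (i , j) with i , j ∈ {0..n} (paper: 1..n+1), i ≠ j.
isVertex : ℕ → ℕ → Bool
isVertex i j = not (i ≡ᵇ j)

adjacent : ℕ → ℕ → ℕ → ℕ → Bool
adjacent i j i' j' =
  ((∣ i - i' ∣ ℕ.+ ∣ j - j' ∣) ≡ᵇ 1)
  ∨ ((i ≡ᵇ j') ∧ (j ≡ᵇ i') ∧ (∣ i - j ∣ ≡ᵇ 1))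

module _ {c ℓ : Level} (R : CommutativeRing c ℓ) where
  open CommutativeRing R

  sumF : (m : ℕ) → (Fin m → Carrier) → Carrier
  sumF zero f = 0#
  sumF (suc m) f = f fzero + sumF m (λ k → f (fsuc k))

  times : ℕ → Carrier → Carrier
  times zero x = 0#
  times (suc n) x = x + times n x

  p : (n : ℕ) → Carrier → ℕ → Fin (suc n) → Fin (suc n) → Carrier
  p n x zero i j = if toℕ i <ᵇ toℕ j then 1# else 0#
  p n x (suc t) i j =
    p n x t i j
    + x * sumF (suc n) (λ i' → sumF (suc n) (λ j' →
        if isVertex (toℕ i') (toℕ j') ∧ adjacent (toℕ i) (toℕ j) (toℕ i') (toℕ j')
        then p n x t i' j' - p n x t i j
        else 0#))

  E : (n : ℕ) → ℕ → Carrier → Carrier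
  E n t x = sumF (suc n) (λ i → sumF (suc n) (λ j →
    if toℕ j <ᵇ toℕ i then p n x t i j else 0#))

  -- Σ_{j=1}^{n} p^{(t)}_{j+1,j}(x)  (0-based: j = 0..n-1, entry (j+1, j))
  subdiag : (n : ℕ) → ℕ → Carrier → Carrier
  subdiag n t x = sumF n (λ j → p n x t (fsuc j) (inject₁ j))

-- Transposition (i,j) ↦ (j,i) is an automorphism of G_n that exchanges the lower and upper
-- triangles and maps p⁽⁰⁾ to 1 - p⁽⁰⁾; by induction on t, p⁽ᵗ⁾ᵢⱼ + p⁽ᵗ⁾ⱼᵢ = 1 for all t.
-- E_{n,t+1} - E_{nt} is x times the net flow of p⁽ᵗ⁾ into the lower triangle {j < i}. Flows along
-- edges inside the lower triangle cancel in pairs, and the only edges leaving it are the extra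
-- edges (j+1,j) ~ (j,j+1), each contributing p⁽ᵗ⁾_{j,j+1} - p⁽ᵗ⁾_{j+1,j} = 1 - 2 p⁽ᵗ⁾_{j+1,j}.
module Submission where

open import Defs
open import Level using (Level)
open import Algebra.Bundles using (CommutativeRing; CommutativeMonoid)
open import Data.Bool using (Bool; true; false; T; if_then_else_; _∧_)
open import Data.Bool.Properties using (T-∧; ∧-commutativeMonoid)
open import Algebra.Properties.CommutativeSemigroup (CommutativeMonoid.commutativeSemigroup ∧-commutativeMonoid)
  using () renaming (x∙yz≈y∙xz to x∧yz≡y∧xz)
open import Data.Nat using (ℕ; zero; suc; _≤_; _≡ᵇ_; _<ᵇ_)
open import Data.Fin using (Fin; toℕ; inject₁) renaming (zero to fzero; suc to fsuc)
open import Data.Fin.Properties using (toℕ-inject₁)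
open import Data.Product using (proj₁)
open import Function.Bundles using (Equivalence)
open import Relation.Binary.PropositionalEquality as ≡ using (_≡_)

open Equivalence using (to)

module Adjacency where
  open import Data.Bool.Properties using (T-∨)
  open import Data.Nat using (_+_; _<_; ∣_-_∣)
  open import Data.Nat.Properties using
    (≡ᵇ⇒≡; ≡⇒≡ᵇ; <ᵇ⇒<; <⇒<ᵇ; ∣m-n∣≡0⇒m≡n; ∣n-n∣≡0; ∣-∣-comm;
     n<1+n; <-irrefl; <-asym; <-trans; <-≤-trans; ≤-pred)
  open import Data.Product using (_×_; _,_)
  open import Data.Sum using (_⊎_; inj₁; inj₂; [_,_]; swap; map)
  open import Data.Empty using (⊥-elim)
  open import Function using (_∘_)
  open import Function.Bundles using (_⇔_; mk⇔)
  open import Relation.Binary.PropositionalEquality using (refl; trans; cong; cong₂)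
  open Equivalence using (from)

  T-injective : ∀ {x y} → (T x → T y) → (T y → T x) → x ≡ y
  T-injective {false} {false} _ _ = refl
  T-injective {false} {true}  _ g = ⊥-elim (g _)
  T-injective {true}  {false} f _ = ⊥-elim (f _)
  T-injective {true}  {true}  _ _ = refl

  m+n≡1⇒m≡0∨m≡1 : ∀ m n → m + n ≡ 1 → (m ≡ 0 × n ≡ 1) ⊎ (m ≡ 1 × n ≡ 0)
  m+n≡1⇒m≡0∨m≡1 zero       n    eq   = inj₁ (refl , eq)
  m+n≡1⇒m≡0∨m≡1 (suc zero) zero refl = inj₂ (refl , refl)

  ∣m-n∣≡1⇒1+m≡n∨m≡1+n : ∀ m n → ∣ m - n ∣ ≡ 1 → suc m ≡ n ⊎ m ≡ suc n
  ∣m-n∣≡1⇒1+m≡n∨m≡1+n zero       (suc zero) _  = inj₁ refl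
  ∣m-n∣≡1⇒1+m≡n∨m≡1+n (suc zero) zero       _  = inj₂ refl
  ∣m-n∣≡1⇒1+m≡n∨m≡1+n (suc m)    (suc n)    eq =
    map (cong suc) (cong suc) (∣m-n∣≡1⇒1+m≡n∨m≡1+n m n eq)

  ∣n-1+n∣≡1 : ∀ n → ∣ n - suc n ∣ ≡ 1
  ∣n-1+n∣≡1 zero    = refl
  ∣n-1+n∣≡1 (suc n) = ∣n-1+n∣≡1 n

  ∣1+n-n∣≡1 : ∀ n → ∣ suc n - n ∣ ≡ 1
  ∣1+n-n∣≡1 n = trans (∣-∣-comm (suc n) n) (∣n-1+n∣≡1 n)

  isVertex-sym : ∀ a b → isVertex a b ≡ isVertex b a
  isVertex-sym zero    zero    = refl
  isVertex-sym zero    (suc b) = refl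
  isVertex-sym (suc a) zero    = refl
  isVertex-sym (suc a) (suc b) = isVertex-sym a b

  isVertex-1+n-n : ∀ n → T (isVertex (suc n) n)
  isVertex-1+n-n zero    = _
  isVertex-1+n-n (suc n) = isVertex-1+n-n n

  -- The edges of G_n, each in one orientation.
  data Step : ℕ → ℕ → ℕ → ℕ → Set where
    down  : ∀ {i j} → Step i j (suc i) j
    right : ∀ {i j} → Step i j i (suc j)
    flip  : ∀ {k} → Step (suc k) k k (suc k)

  Adjacent : ℕ → ℕ → ℕ → ℕ → Set
  Adjacent a b c d = Step a b c d ⊎ Step c d a b

  Step-transpose : ∀ {a b c d} → Step a b c d → Adjacent b a d c
  Step-transpose down  = inj₁ right
  Step-transpose right = inj₁ down
  Step-transpose flip  = inj₂ flip

  Adjacent-transpose : ∀ {a b c d} → Adjacent a b c d → Adjacent b a d c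
  Adjacent-transpose = [ Step-transpose , swap ∘ Step-transpose ]

  Adjacent-lower-upper : ∀ {a b c d} → b < a → c < d → Adjacent a b c d →
                         a ≡ suc b × c ≡ b × d ≡ a
  Adjacent-lower-upper b<a c<d (inj₁ down)  = ⊥-elim (<-asym b<a (<-trans (n<1+n _) c<d))
  Adjacent-lower-upper b<a c<d (inj₁ right) = ⊥-elim (<-irrefl refl (<-≤-trans b<a (≤-pred c<d)))
  Adjacent-lower-upper b<a c<d (inj₁ flip)  = refl , refl , refl
  Adjacent-lower-upper b<a c<d (inj₂ down)  = ⊥-elim (<-irrefl refl (<-≤-trans c<d (≤-pred b<a)))
  Adjacent-lower-upper b<a c<d (inj₂ right) = ⊥-elim (<-asym c<d (<-trans (n<1+n _) b<a))
  Adjacent-lower-upper b<a c<d (inj₂ flip)  = ⊥-elim (<-asym (n<1+n _) c<d)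

  unit-distance⇒adjacent : ∀ a b c d → ∣ a - c ∣ + ∣ b - d ∣ ≡ 1 → T (adjacent a b c d)
  unit-distance⇒adjacent _ _ _ _ eq = from T-∨ (inj₁ (≡⇒≡ᵇ _ 1 eq))

  swapped⇒adjacent : ∀ a b → ∣ a - b ∣ ≡ 1 → T (adjacent a b b a)
  swapped⇒adjacent a b eq =
    from T-∨ (inj₂ (from T-∧ (≡⇒≡ᵇ a a refl , from T-∧ (≡⇒≡ᵇ b b refl , ≡⇒≡ᵇ _ 1 eq))))

  Step⇒adjacent : ∀ {a b c d} → Step a b c d → T (adjacent a b c d)
  Step⇒adjacent (down {i} {j})  =
    unit-distance⇒adjacent i j (suc i) j (cong₂ _+_ (∣n-1+n∣≡1 i) (∣n-n∣≡0 j))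
  Step⇒adjacent (right {i} {j}) =
    unit-distance⇒adjacent i j i (suc j) (cong₂ _+_ (∣n-n∣≡0 i) (∣n-1+n∣≡1 j))
  Step⇒adjacent (flip {k})      = swapped⇒adjacent (suc k) k (∣1+n-n∣≡1 k)

  Step⇒adjacent⁻ : ∀ {a b c d} → Step c d a b → T (adjacent a b c d)
  Step⇒adjacent⁻ (down {i} {j})  =
    unit-distance⇒adjacent (suc i) j i j (cong₂ _+_ (∣1+n-n∣≡1 i) (∣n-n∣≡0 j))
  Step⇒adjacent⁻ (right {i} {j}) =
    unit-distance⇒adjacent i (suc j) i j (cong₂ _+_ (∣n-n∣≡0 i) (∣1+n-n∣≡1 j))
  Step⇒adjacent⁻ (flip {k})      = swapped⇒adjacent k (suc k) (∣n-1+n∣≡1 k)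

  unit-distance⇒Adjacent : ∀ a b c d → ∣ a - c ∣ + ∣ b - d ∣ ≡ 1 → Adjacent a b c d
  unit-distance⇒Adjacent a b c d eq with m+n≡1⇒m≡0∨m≡1 ∣ a - c ∣ ∣ b - d ∣ eq
  ... | inj₁ (e₀ , e₁) with ∣m-n∣≡0⇒m≡n {a} {c} e₀ | ∣m-n∣≡1⇒1+m≡n∨m≡1+n b d e₁
  ...   | refl | inj₁ refl = inj₁ right
  ...   | refl | inj₂ refl = inj₂ right
  unit-distance⇒Adjacent a b c d eq | inj₂ (e₁ , e₀)
    with ∣m-n∣≡0⇒m≡n {b} {d} e₀ | ∣m-n∣≡1⇒1+m≡n∨m≡1+n a c e₁
  ...   | refl | inj₁ refl = inj₁ down
  ...   | refl | inj₂ refl = inj₂ down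

  swapped⇒Adjacent : ∀ a b → ∣ a - b ∣ ≡ 1 → Adjacent a b b a
  swapped⇒Adjacent a b eq with ∣m-n∣≡1⇒1+m≡n∨m≡1+n a b eq
  ... | inj₁ refl = inj₂ flip
  ... | inj₂ refl = inj₁ flip

  adjacent⇔Adjacent : ∀ a b c d → T (adjacent a b c d) ⇔ Adjacent a b c d
  adjacent⇔Adjacent a b c d = mk⇔ adjacent⇒Adjacent [ Step⇒adjacent , Step⇒adjacent⁻ ]
    where
    adjacent⇒Adjacent : T (adjacent a b c d) → Adjacent a b c d
    adjacent⇒Adjacent adj with to T-∨ adj
    ... | inj₁ unit = unit-distance⇒Adjacent a b c d (≡ᵇ⇒≡ _ 1 unit)
    ... | inj₂ sw with to T-∧ sw
    ...   | a≡d , sw′ with to T-∧ sw′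
    ...     | b≡c , dist with ≡ᵇ⇒≡ a d a≡d | ≡ᵇ⇒≡ b c b≡c
    ...       | refl | refl = swapped⇒Adjacent a b (≡ᵇ⇒≡ _ 1 dist)

  adjacent-sym : ∀ a b c d → adjacent a b c d ≡ adjacent c d a b
  adjacent-sym a b c d = T-injective
    (from (adjacent⇔Adjacent c d a b) ∘ swap ∘ to (adjacent⇔Adjacent a b c d))
    (from (adjacent⇔Adjacent a b c d) ∘ swap ∘ to (adjacent⇔Adjacent c d a b))

  adjacent-transpose : ∀ a b c d → adjacent b a d c ≡ adjacent a b c d
  adjacent-transpose a b c d = T-injective
    (from (adjacent⇔Adjacent a b c d) ∘ Adjacent-transpose ∘ to (adjacent⇔Adjacent b a d c))
    (from (adjacent⇔Adjacent b a d c) ∘ Adjacent-transpose ∘ to (adjacent⇔Adjacent a b c d))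

  lower-adjacent-upper : ∀ a b c d →
    (b <ᵇ a) ∧ ((c <ᵇ d) ∧ adjacent a b c d) ≡ (suc b ≡ᵇ a) ∧ ((c ≡ᵇ b) ∧ (d ≡ᵇ a))
  lower-adjacent-upper a b c d = T-injective lower-upper⇒flip flip⇒lower-upper
    where
    lower-upper⇒flip : T ((b <ᵇ a) ∧ ((c <ᵇ d) ∧ adjacent a b c d)) →
                       T ((suc b ≡ᵇ a) ∧ ((c ≡ᵇ b) ∧ (d ≡ᵇ a)))
    lower-upper⇒flip h with to T-∧ h
    ... | b<a , h′ with to T-∧ h′
    ...   | c<d , adj
      with Adjacent-lower-upper (<ᵇ⇒< b a b<a) (<ᵇ⇒< c d c<d) (to (adjacent⇔Adjacent a b c d) adj)
    ...     | refl , refl , refl =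
      from T-∧ (≡⇒≡ᵇ a a refl , from T-∧ (≡⇒≡ᵇ b b refl , ≡⇒≡ᵇ a a refl))
    flip⇒lower-upper : T ((suc b ≡ᵇ a) ∧ ((c ≡ᵇ b) ∧ (d ≡ᵇ a))) →
                       T ((b <ᵇ a) ∧ ((c <ᵇ d) ∧ adjacent a b c d))
    flip⇒lower-upper h with to T-∧ h
    ... | a≡1+b , h′ with to T-∧ h′
    ...   | c≡b , d≡a with ≡ᵇ⇒≡ (suc b) a a≡1+b | ≡ᵇ⇒≡ c b c≡b | ≡ᵇ⇒≡ d a d≡a
    ...     | refl | refl | refl = from T-∧ (b<1+b , from T-∧ (b<1+b , Step⇒adjacent (flip {b})))
      where b<1+b = <⇒<ᵇ (n<1+n b)

open Adjacency

module _ {c ℓ : Level} (R : CommutativeRing c ℓ) where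
  open CommutativeRing R
  open import Algebra.Properties.Semiring.Sum semiring
  open import Algebra.Properties.Ring ring using (+-inverseʳ-unique; -0#≈0#; -‿+-comm; y≈x\\z; x[y-z]≈xy-xz)
  open import Algebra.Properties.CommutativeSemigroup +-commutativeSemigroup using (interchange)
  open import Relation.Binary.Reasoning.Setoid setoid

  sumF≡sum : ∀ m (f : Fin m → Carrier) → sumF R m f ≡ sum f
  sumF≡sum zero    f = ≡.refl
  sumF≡sum (suc m) f = ≡.cong (f fzero +_) (sumF≡sum m (λ k → f (fsuc k)))

  ∑² : ∀ {m m′} → (Fin m → Fin m′ → Carrier) → Carrier
  ∑² f = sum (λ i → sum (λ j → f i j))

  sumF²≡∑² : ∀ m m′ (f : Fin m → Fin m′ → Carrier) → sumF R m (λ i → sumF R m′ (f i)) ≡ ∑² f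
  sumF²≡∑² m m′ f =
    ≡.trans (sumF≡sum m (λ i → sumF R m′ (f i))) (sum-cong-≗ (λ i → sumF≡sum m′ (f i)))

  x*∑1≈times : ∀ m x → x * sum {m} (λ _ → 1#) ≈ times R m x
  x*∑1≈times zero    x = zeroʳ x
  x*∑1≈times (suc m) x = trans (distribˡ x 1# _) (+-cong (*-identityʳ x) (x*∑1≈times m x))

  ∑-neg : ∀ {m} (f : Fin m → Carrier) → sum (λ k → - f k) ≈ - sum f
  ∑-neg {m} f = +-inverseʳ-unique (sum f) _
    (trans (sym (∑-distrib-+ f (λ k → - f k)))
      (trans (sum-cong-≋ {m} (λ k → -‿inverseʳ (f k))) (sum-replicate-zero m)))

  ∑²-cong : ∀ {m m′} {f g : Fin m → Fin m′ → Carrier} → (∀ i j → f i j ≈ g i j) → ∑² f ≈ ∑² g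
  ∑²-cong f≈g = sum-cong-≋ (λ i → sum-cong-≋ (f≈g i))

  ∑²-zero : ∀ {m m′} → ∑² {m} {m′} (λ _ _ → 0#) ≈ 0#
  ∑²-zero {m} {m′} = trans (sum-cong-≋ {m} (λ _ → sum-replicate-zero m′)) (sum-replicate-zero m)

  ∑²-distrib-+ : ∀ {m m′} (f g : Fin m → Fin m′ → Carrier) →
                 ∑² (λ i j → f i j + g i j) ≈ ∑² f + ∑² g
  ∑²-distrib-+ f g = trans (sum-cong-≋ (λ i → ∑-distrib-+ (f i) (g i)))
                           (∑-distrib-+ (λ i → sum (f i)) (λ i → sum (g i)))

  ∑²-neg : ∀ {m m′} (f : Fin m → Fin m′ → Carrier) → ∑² (λ i j → - f i j) ≈ - ∑² f
  ∑²-neg f = trans (sum-cong-≋ (λ i → ∑-neg (f i))) (∑-neg (λ i → sum (f i)))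

  *-distribˡ-∑² : ∀ {m m′} y (f : Fin m → Fin m′ → Carrier) → y * ∑² f ≈ ∑² (λ i j → y * f i j)
  *-distribˡ-∑² y f = trans (*-distribˡ-sum y (λ i → sum (f i))) (sum-cong-≋ (λ i → *-distribˡ-sum y (f i)))

  ∑²-comm : ∀ {m m′} (f : Fin m → Fin m′ → Fin m → Fin m′ → Carrier) →
            ∑² (λ i j → ∑² (f i j)) ≈ ∑² (λ i′ j′ → ∑² (λ i j → f i j i′ j′))
  ∑²-comm f = begin
    sum (λ i → sum (λ j → sum (λ i′ → sum (f i j i′))))
      ≈⟨ sum-cong-≋ (λ i → ∑-comm (λ j i′ → sum (f i j i′))) ⟩
    sum (λ i → sum (λ i′ → sum (λ j → sum (f i j i′))))
      ≈⟨ ∑-comm (λ i i′ → sum (λ j → sum (f i j i′))) ⟩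
    sum (λ i′ → sum (λ i → sum (λ j → sum (f i j i′))))
      ≈⟨ sum-cong-≋ (λ i′ → sum-cong-≋ (λ i → ∑-comm (λ j → f i j i′))) ⟩
    sum (λ i′ → sum (λ i → sum (λ j′ → sum (λ j → f i j i′ j′))))
      ≈⟨ sum-cong-≋ (λ i′ → ∑-comm (λ i j′ → sum (λ j → f i j i′ j′))) ⟩
    sum (λ i′ → sum (λ j′ → sum (λ i → sum (λ j → f i j i′ j′)))) ∎

  if-cong : ∀ b {u v} → u ≈ v → (if b then u else 0#) ≈ (if b then v else 0#)
  if-cong true  u≈v = u≈v
  if-cong false _   = refl

  if-∧ : ∀ b b′ u → (if b ∧ b′ then u else 0#) ≡ (if b then (if b′ then u else 0#) else 0#)
  if-∧ true  b′ u = ≡.refl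
  if-∧ false b′ u = ≡.refl

  if-+ : ∀ b u v → (if b then u + v else 0#) ≈ (if b then u else 0#) + (if b then v else 0#)
  if-+ true  u v = refl
  if-+ false u v = sym (+-identityˡ 0#)

  if-* : ∀ b y u → (if b then y * u else 0#) ≈ y * (if b then u else 0#)
  if-* true  y u = refl
  if-* false y u = sym (zeroʳ y)

  if-minus : ∀ b u v → (if b then u - v else 0#) ≈ (if b then u else 0#) - (if b then v else 0#)
  if-minus true  u v = refl
  if-minus false u v = sym (trans (+-identityˡ _) -0#≈0#)

  if-negate : ∀ b {u v} → (T b → u ≈ - v) → (if b then u else 0#) ≈ - (if b then v else 0#)
  if-negate true  u≈-v = u≈-v _
  if-negate false _    = sym -0#≈0#

  if-∑ : ∀ {m} b (f : Fin m → Carrier) →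
         (if b then sum f else 0#) ≈ sum (λ k → if b then f k else 0#)
  if-∑ true  f = refl
  if-∑ {m} false f = sym (sum-replicate-zero m)

  if-∑² : ∀ {m m′} b (f : Fin m → Fin m′ → Carrier) →
          (if b then ∑² f else 0#) ≈ ∑² (λ i j → if b then f i j else 0#)
  if-∑² true  f = refl
  if-∑² {m} {m′} false f = sym (∑²-zero {m} {m′})

  ∑²-symmetric-flow≈0 : ∀ {m m′} (c : Fin m → Fin m′ → Fin m → Fin m′ → Bool) →
    (∀ i j i′ j′ → c i′ j′ i j ≡ c i j i′ j′) → (u : Fin m → Fin m′ → Carrier) →
    ∑² (λ i j → ∑² (λ i′ j′ → if c i j i′ j′ then u i′ j′ - u i j else 0#)) ≈ 0#
  ∑²-symmetric-flow≈0 {m} {m′} c c-sym u = begin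
    ∑² (λ i j → ∑² (λ i′ j′ → if c i j i′ j′ then u i′ j′ - u i j else 0#))
      ≈⟨ ∑²-cong (λ i j → ∑²-cong (λ i′ j′ → if-minus (c i j i′ j′) _ _)) ⟩
    ∑² (λ i j → ∑² (λ i′ j′ → inflow i j i′ j′ - outflow i j i′ j′))
      ≈⟨ ∑²-cong (λ i j → trans (∑²-distrib-+ (inflow i j) (λ i′ j′ → - outflow i j i′ j′))
                                (+-congˡ (∑²-neg (outflow i j)))) ⟩
    ∑² (λ i j → ∑² (inflow i j) - ∑² (outflow i j))
      ≈⟨ trans (∑²-distrib-+ (λ i j → ∑² (inflow i j)) (λ i j → - ∑² (outflow i j)))
               (+-congˡ (∑²-neg (λ i j → ∑² (outflow i j)))) ⟩
    ∑² (λ i j → ∑² (inflow i j)) - ∑² (λ i j → ∑² (outflow i j))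
      ≈⟨ +-congʳ (trans (∑²-comm inflow) (∑²-cong (λ i j → ∑²-cong (λ i′ j′ → reflexive
           (≡.cong (if_then u i j else 0#) (c-sym i j i′ j′)))))) ⟩
    ∑² (λ i j → ∑² (outflow i j)) - ∑² (λ i j → ∑² (outflow i j))
      ≈⟨ -‿inverseʳ _ ⟩
    0# ∎
    where
    inflow outflow : Fin m → Fin m′ → Fin m → Fin m′ → Carrier
    inflow  i j i′ j′ = if c i j i′ j′ then u i′ j′ else 0#
    outflow i j i′ j′ = if c i j i′ j′ then u i j else 0#

  ∑-δ : ∀ {m} (h : Fin m → Carrier) (a : Fin m) {k} → toℕ a ≡ k →
        sum (λ j → if toℕ j ≡ᵇ k then h j else 0#) ≈ h a
  ∑-δ {suc m} h fzero    ≡.refl = trans (+-congˡ (sum-replicate-zero m)) (+-identityʳ _)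
  ∑-δ         h (fsuc a) ≡.refl = trans (+-identityˡ _) (∑-δ (λ j → h (fsuc j)) a ≡.refl)

  ∑²-δ : ∀ {m m′} (h : Fin m → Fin m′ → Carrier) a b →
         ∑² (λ i j → if (toℕ i ≡ᵇ toℕ a) ∧ (toℕ j ≡ᵇ toℕ b) then h i j else 0#) ≈ h a b
  ∑²-δ {m} {m′} h a b = begin
    ∑² (λ i j → if (toℕ i ≡ᵇ toℕ a) ∧ (toℕ j ≡ᵇ toℕ b) then h i j else 0#)
      ≈⟨ ∑²-cong (λ i j → reflexive (if-∧ (toℕ i ≡ᵇ toℕ a) (toℕ j ≡ᵇ toℕ b) (h i j))) ⟩
    ∑[ i < m ] ∑[ j < m′ ] (if toℕ i ≡ᵇ toℕ a then (if toℕ j ≡ᵇ toℕ b then h i j else 0#) else 0#)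
      ≈⟨ sum-cong-≋ {m} (λ i →
           sym (if-∑ (toℕ i ≡ᵇ toℕ a) (λ j → if toℕ j ≡ᵇ toℕ b then h i j else 0#))) ⟩
    ∑[ i < m ] (if toℕ i ≡ᵇ toℕ a then ∑[ j < m′ ] (if toℕ j ≡ᵇ toℕ b then h i j else 0#) else 0#)
      ≈⟨ sum-cong-≋ {m} (λ i → if-cong (toℕ i ≡ᵇ toℕ a) (∑-δ (h i) b ≡.refl)) ⟩
    ∑[ i < m ] (if toℕ i ≡ᵇ toℕ a then h i b else 0#)
      ≈⟨ ∑-δ (λ i → h i b) a ≡.refl ⟩
    h a b ∎

  ∑²-subdiagonal : ∀ {n} (g : Fin (suc n) → Fin (suc n) → Carrier) →
    ∑² (λ i j → if suc (toℕ j) ≡ᵇ toℕ i then g i j else 0#) ≈ sum (λ k → g (fsuc k) (inject₁ k))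
  -- Row 0 contributes nothing and row k+1 is a Kronecker delta at column k.
  ∑²-subdiagonal {n} g =
    trans (+-cong (sum-replicate-zero (suc n))
                  (sum-cong-≋ (λ k → ∑-δ (g (fsuc k)) (inject₁ k) (toℕ-inject₁ k))))
          (+-identityˡ _)

  complement-difference : ∀ {a a′ b b′} → a + a′ ≈ 1# → b + b′ ≈ 1# → a′ - b′ ≈ - (a - b)
  complement-difference {a} {a′} {b} {b′} a+a′≈1 b+b′≈1 = +-inverseʳ-unique (a - b) (a′ - b′) (begin
    (a - b) + (a′ - b′)      ≈⟨ interchange a (- b) a′ (- b′) ⟩
    (a + a′) + (- b + - b′)  ≈⟨ +-cong a+a′≈1 (trans (-‿+-comm b b′) (-‿cong b+b′≈1)) ⟩
    1# - 1#                  ≈⟨ -‿inverseʳ 1# ⟩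
    0#                       ∎)

  complement-minus-self : ∀ {a b} → a + b ≈ 1# → b - a ≈ 1# - (1# + 1#) * a
  complement-minus-self {a} {b} a+b≈1 = begin
    b - a                ≈⟨ +-congʳ (trans (y≈x\\z a b 1# a+b≈1) (+-comm (- a) 1#)) ⟩
    (1# - a) - a         ≈⟨ +-assoc 1# (- a) (- a) ⟩
    1# + (- a + - a)     ≈⟨ +-congˡ (-‿+-comm a a) ⟩
    1# - (a + a)         ≈⟨ +-congˡ (-‿cong (trans (distribʳ a 1# 1#) (+-cong (*-identityˡ a) (*-identityˡ a)))) ⟨
    1# - (1# + 1#) * a   ∎

  w+x[y-cz]≈w+xy-[cx]z : ∀ w x y c z → w + x * (y - c * z) ≈ (w + x * y) - (c * x) * z
  w+x[y-cz]≈w+xy-[cx]z w x y c z = begin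
    w + x * (y - c * z)        ≈⟨ +-congˡ (x[y-z]≈xy-xz x y (c * z)) ⟩
    w + (x * y - x * (c * z))  ≈⟨ +-assoc w (x * y) _ ⟨
    (w + x * y) - x * (c * z)  ≈⟨ +-congˡ (-‿cong (trans (sym (*-assoc x c z)) (*-congʳ (*-comm x c)))) ⟩
    (w + x * y) - (c * x) * z  ∎

  if-isVertex-split : ∀ a b β u → (if isVertex a b ∧ β then u else 0#) ≈
                (if (b <ᵇ a) ∧ β then u else 0#) + (if (a <ᵇ b) ∧ β then u else 0#)
  if-isVertex-split zero    zero    β u = sym (+-identityˡ 0#)
  if-isVertex-split zero    (suc b) β u = sym (+-identityˡ _)
  if-isVertex-split (suc a) zero    β u = sym (+-identityʳ _)
  if-isVertex-split (suc a) (suc b) β u = if-isVertex-split a b β u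

  <ᵇ-complement : ∀ a b → T (isVertex a b) →
                  (if a <ᵇ b then 1# else 0#) + (if b <ᵇ a then 1# else 0#) ≈ 1#
  <ᵇ-complement zero    (suc b) _ = +-identityʳ 1#
  <ᵇ-complement (suc a) zero    _ = +-identityˡ 1#
  <ᵇ-complement (suc a) (suc b) v = <ᵇ-complement a b v

  module Graph (n : ℕ) where
    Region : Set
    Region = Fin (suc n) → Fin (suc n) → Bool

    VertexFunction : Set c
    VertexFunction = Fin (suc n) → Fin (suc n) → Carrier

    vertex lower upper : Region
    vertex i j = isVertex (toℕ i) (toℕ j)
    lower  i j = toℕ j <ᵇ toℕ i
    upper  i j = toℕ i <ᵇ toℕ j

    adj : Fin (suc n) → Fin (suc n) → Region
    adj i j i′ j′ = adjacent (toℕ i) (toℕ j) (toℕ i′) (toℕ j′)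

    flowFrom : Region → VertexFunction → VertexFunction
    flowFrom S u i j = ∑² (λ i′ j′ → if S i′ j′ ∧ adj i j i′ j′ then u i′ j′ - u i j else 0#)

    onLower : VertexFunction → Carrier
    onLower u = ∑² (λ i j → if lower i j then u i j else 0#)

    Complementary : VertexFunction → Set ℓ
    Complementary u = ∀ i j → T (vertex i j) → u i j + u j i ≈ 1#

    flowFrom-split : ∀ u i j → flowFrom vertex u i j ≈ flowFrom lower u i j + flowFrom upper u i j
    flowFrom-split u i j = trans
      (∑²-cong (λ i′ j′ → if-isVertex-split (toℕ i′) (toℕ j′) (adj i j i′ j′) (u i′ j′ - u i j)))
      (∑²-distrib-+ (λ i′ j′ → if lower i′ j′ ∧ adj i j i′ j′ then u i′ j′ - u i j else 0#)
                    (λ i′ j′ → if upper i′ j′ ∧ adj i j i′ j′ then u i′ j′ - u i j else 0#))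

    flowFrom-transpose : ∀ {u} → Complementary u → ∀ i j → T (vertex i j) →
                         flowFrom vertex u j i ≈ - flowFrom vertex u i j
    flowFrom-transpose {u} u-compl i j v = begin
      flowFrom vertex u j i
        ≈⟨ ∑-comm (λ b a → F b a) ⟩
      ∑² (λ a b → F b a)
        ≈⟨ ∑²-cong (λ a b → trans (reflexive (≡.cong (if_then u b a - u j i else 0#) (transposed a b)))
             (if-negate (vertex a b ∧ adj i j a b) (λ h →
               complement-difference (u-compl a b (proj₁ (to T-∧ h))) (u-compl i j v)))) ⟩
      ∑² (λ a b → - (if vertex a b ∧ adj i j a b then u a b - u i j else 0#))
        ≈⟨ ∑²-neg (λ a b → if vertex a b ∧ adj i j a b then u a b - u i j else 0#) ⟩
      - flowFrom vertex u i j ∎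
      where
      F : VertexFunction
      F b a = if vertex b a ∧ adj j i b a then u b a - u j i else 0#
      transposed : ∀ a b → vertex b a ∧ adj j i b a ≡ vertex a b ∧ adj i j a b
      transposed a b =
        ≡.cong₂ _∧_ (isVertex-sym (toℕ b) (toℕ a)) (adjacent-transpose (toℕ i) (toℕ j) (toℕ a) (toℕ b))

    onLower-cong : ∀ {u v} → (∀ i j → u i j ≈ v i j) → onLower u ≈ onLower v
    onLower-cong u≈v = ∑²-cong (λ i j → if-cong (lower i j) (u≈v i j))

    onLower-+ : ∀ u v → onLower (λ i j → u i j + v i j) ≈ onLower u + onLower v
    onLower-+ u v = trans (∑²-cong (λ i j → if-+ (lower i j) (u i j) (v i j)))
      (∑²-distrib-+ (λ i j → if lower i j then u i j else 0#) (λ i j → if lower i j then v i j else 0#))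

    onLower-* : ∀ y u → onLower (λ i j → y * u i j) ≈ y * onLower u
    onLower-* y u = trans (∑²-cong (λ i j → if-* (lower i j) y (u i j)))
      (sym (*-distribˡ-∑² y (λ i j → if lower i j then u i j else 0#)))

    onLower-flowFrom : ∀ S u → onLower (flowFrom S u) ≈
      ∑² (λ i j → ∑² (λ i′ j′ → if lower i j ∧ (S i′ j′ ∧ adj i j i′ j′) then u i′ j′ - u i j else 0#))
    onLower-flowFrom S u = ∑²-cong (λ i j → trans
      (if-∑² (lower i j) (λ i′ j′ → if S i′ j′ ∧ adj i j i′ j′ then u i′ j′ - u i j else 0#))
      (∑²-cong (λ i′ j′ → reflexive
        (≡.sym (if-∧ (lower i j) (S i′ j′ ∧ adj i j i′ j′) (u i′ j′ - u i j))))))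

    onLower-flowFrom-lower : ∀ u → onLower (flowFrom lower u) ≈ 0#
    onLower-flowFrom-lower u = trans (onLower-flowFrom lower u)
      (∑²-symmetric-flow≈0 (λ i j i′ j′ → lower i j ∧ (lower i′ j′ ∧ adj i j i′ j′)) lower-adj-sym u)
      where
      lower-adj-sym : ∀ i j i′ j′ →
        lower i′ j′ ∧ (lower i j ∧ adj i′ j′ i j) ≡ lower i j ∧ (lower i′ j′ ∧ adj i j i′ j′)
      lower-adj-sym i j i′ j′ = ≡.trans
        (≡.cong (λ b → lower i′ j′ ∧ (lower i j ∧ b)) (adjacent-sym (toℕ i′) (toℕ j′) (toℕ i) (toℕ j)))
        (x∧yz≡y∧xz (lower i′ j′) (lower i j) (adj i j i′ j′))

    onLower-flowFrom-upper : ∀ u → onLower (flowFrom upper u) ≈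
                             sum (λ k → u (inject₁ k) (fsuc k) - u (fsuc k) (inject₁ k))
    onLower-flowFrom-upper u = begin
      onLower (flowFrom upper u)
        ≈⟨ onLower-flowFrom upper u ⟩
      ∑² (λ i j → ∑² (λ i′ j′ → if lower i j ∧ (upper i′ j′ ∧ adj i j i′ j′) then u i′ j′ - u i j else 0#))
        ≈⟨ ∑²-cong (λ i j → ∑²-cong (λ i′ j′ → reflexive (≡.cong (if_then u i′ j′ - u i j else 0#)
             (lower-adjacent-upper (toℕ i) (toℕ j) (toℕ i′) (toℕ j′))))) ⟩
      ∑² (λ i j → ∑² (λ i′ j′ → if subdiagonal i j ∧ transposeOf i j i′ j′ then u i′ j′ - u i j else 0#))
        ≈⟨ ∑²-cong flip-edge ⟩
      ∑² (λ i j → if subdiagonal i j then u j i - u i j else 0#)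
        ≈⟨ ∑²-subdiagonal (λ i j → u j i - u i j) ⟩
      sum (λ k → u (inject₁ k) (fsuc k) - u (fsuc k) (inject₁ k)) ∎
      where
      subdiagonal : Region
      subdiagonal i j = suc (toℕ j) ≡ᵇ toℕ i
      transposeOf : Fin (suc n) → Fin (suc n) → Region
      transposeOf i j i′ j′ = (toℕ i′ ≡ᵇ toℕ j) ∧ (toℕ j′ ≡ᵇ toℕ i)
      flip-edge : ∀ i j →
        ∑² (λ i′ j′ → if subdiagonal i j ∧ transposeOf i j i′ j′ then u i′ j′ - u i j else 0#)
        ≈ (if subdiagonal i j then u j i - u i j else 0#)
      flip-edge i j = begin
        ∑² (λ i′ j′ → if subdiagonal i j ∧ transposeOf i j i′ j′ then u i′ j′ - u i j else 0#)
          ≈⟨ ∑²-cong (λ i′ j′ →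
               reflexive (if-∧ (subdiagonal i j) (transposeOf i j i′ j′) (u i′ j′ - u i j))) ⟩
        ∑² (λ i′ j′ → if subdiagonal i j then (if transposeOf i j i′ j′ then u i′ j′ - u i j else 0#) else 0#)
          ≈⟨ if-∑² (subdiagonal i j) (λ i′ j′ → if transposeOf i j i′ j′ then u i′ j′ - u i j else 0#) ⟨
        (if subdiagonal i j then ∑² (λ i′ j′ → if transposeOf i j i′ j′ then u i′ j′ - u i j else 0#) else 0#)
          ≈⟨ if-cong (subdiagonal i j) (∑²-δ (λ i′ j′ → u i′ j′ - u i j) j i) ⟩
        (if subdiagonal i j then u j i - u i j else 0#) ∎

    subdiagonal-vertex : ∀ k → T (vertex (fsuc k) (inject₁ k))
    subdiagonal-vertex k =
      ≡.subst (λ b → T (isVertex (suc (toℕ k)) b)) (≡.sym (toℕ-inject₁ k)) (isVertex-1+n-n (toℕ k))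

    onLower-flow : ∀ {u} → Complementary u → onLower (flowFrom vertex u) ≈
                   sum {n} (λ _ → 1#) - (1# + 1#) * sum (λ k → u (fsuc k) (inject₁ k))
    onLower-flow {u} u-compl = begin
      onLower (flowFrom vertex u)
        ≈⟨ trans (onLower-cong (flowFrom-split u)) (onLower-+ (flowFrom lower u) (flowFrom upper u)) ⟩
      onLower (flowFrom lower u) + onLower (flowFrom upper u)
        ≈⟨ trans (+-cong (onLower-flowFrom-lower u) (onLower-flowFrom-upper u)) (+-identityˡ _) ⟩
      sum (λ k → u (inject₁ k) (fsuc k) - u (fsuc k) (inject₁ k))
        ≈⟨ sum-cong-≋ (λ k → complement-minus-self (u-compl (fsuc k) (inject₁ k) (subdiagonal-vertex k))) ⟩
      sum (λ k → 1# - (1# + 1#) * u (fsuc k) (inject₁ k))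
        ≈⟨ ∑-distrib-+ (λ _ → 1#) (λ k → - ((1# + 1#) * u (fsuc k) (inject₁ k))) ⟩
      sum {n} (λ _ → 1#) + sum (λ k → - ((1# + 1#) * u (fsuc k) (inject₁ k)))
        ≈⟨ +-congˡ (trans (∑-neg (λ k → (1# + 1#) * u (fsuc k) (inject₁ k)))
                          (-‿cong (sym (*-distribˡ-sum (1# + 1#) (λ k → u (fsuc k) (inject₁ k)))))) ⟩
      sum {n} (λ _ → 1#) - (1# + 1#) * sum (λ k → u (fsuc k) (inject₁ k)) ∎

  module Diffusion (n : ℕ) (x : Carrier) where
    open Graph n

    p-suc : ∀ t i j → p R n x (suc t) i j ≡ p R n x t i j + x * flowFrom vertex (p R n x t) i j
    p-suc t i j = ≡.cong (λ s → p R n x t i j + x * s) (sumF²≡∑² (suc n) (suc n)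
      (λ i′ j′ → if vertex i′ j′ ∧ adj i j i′ j′ then p R n x t i′ j′ - p R n x t i j else 0#))

    p-complementary : ∀ t → Complementary (p R n x t)
    p-complementary zero    i j v = <ᵇ-complement (toℕ i) (toℕ j) v
    p-complementary (suc t) i j v = begin
      p R n x (suc t) i j + p R n x (suc t) j i
        ≡⟨ ≡.cong₂ _+_ (p-suc t i j) (p-suc t j i) ⟩
      (P i j + x * Φ i j) + (P j i + x * Φ j i)
        ≈⟨ interchange (P i j) (x * Φ i j) (P j i) (x * Φ j i) ⟩
      (P i j + P j i) + (x * Φ i j + x * Φ j i)
        ≈⟨ +-cong (p-complementary t i j v) flows-cancel ⟩
      1# + 0#
        ≈⟨ +-identityʳ 1# ⟩
      1# ∎
      where
      P : VertexFunction
      P = p R n x t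
      Φ : VertexFunction
      Φ = flowFrom vertex P
      flows-cancel : x * Φ i j + x * Φ j i ≈ 0#
      flows-cancel = begin
        x * Φ i j + x * Φ j i  ≈⟨ distribˡ x (Φ i j) (Φ j i) ⟨
        x * (Φ i j + Φ j i)    ≈⟨ *-congˡ (trans (+-congˡ (flowFrom-transpose (p-complementary t) i j v))
                                                     (-‿inverseʳ (Φ i j))) ⟩
        x * 0#                 ≈⟨ zeroʳ x ⟩
        0#                     ∎

    E≡onLower : ∀ t → E R n t x ≡ onLower (p R n x t)
    E≡onLower t = sumF²≡∑² (suc n) (suc n) (λ i j → if lower i j then p R n x t i j else 0#)

    subdiag≡sum : ∀ t → subdiag R n t x ≡ sum (λ k → p R n x t (fsuc k) (inject₁ k))
    subdiag≡sum t = sumF≡sum n (λ k → p R n x t (fsuc k) (inject₁ k))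

    onLower-suc : ∀ t → onLower (p R n x (suc t)) ≈
                  onLower (p R n x t) + x * onLower (flowFrom vertex (p R n x t))
    onLower-suc t = trans (onLower-cong (λ i j → reflexive (p-suc t i j)))
      (trans (onLower-+ (p R n x t) (λ i j → x * flowFrom vertex (p R n x t) i j))
             (+-congˡ (onLower-* x (flowFrom vertex (p R n x t)))))

proposition3 : {c ℓ : Level} (R : CommutativeRing c ℓ) (n : ℕ) → 1 ≤ n →
    (x : CommutativeRing.Carrier R) (t : ℕ) →
    CommutativeRing._≈_ R (E R n (suc t) x)
      (CommutativeRing._-_ R
        (CommutativeRing._+_ R (E R n t x) (times R n x))
        (CommutativeRing._*_ R
          (CommutativeRing._*_ R (CommutativeRing._+_ R (CommutativeRing.1# R) (CommutativeRing.1# R)) x)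
          (subdiag R n t x)))
-- The identity also holds for n = 0.
proposition3 R n _ x t = begin
  E R n (suc t) x
    ≡⟨ E≡onLower (suc t) ⟩
  onLower (P (suc t))
    ≈⟨ onLower-suc t ⟩
  onLower (P t) + x * onLower (flowFrom vertex (P t))
    ≈⟨ +-congˡ (*-congˡ (onLower-flow (p-complementary t))) ⟩
  onLower (P t) + x * (∑1 - (1# + 1#) * sum (λ k → P t (fsuc k) (inject₁ k)))
    ≈⟨ w+x[y-cz]≈w+xy-[cx]z R (onLower (P t)) x ∑1 (1# + 1#) (sum (λ k → P t (fsuc k) (inject₁ k))) ⟩
  (onLower (P t) + x * ∑1) - ((1# + 1#) * x) * sum (λ k → P t (fsuc k) (inject₁ k))
    ≡⟨ ≡.cong₂ (λ e s → (e + x * ∑1) - ((1# + 1#) * x) * s)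
               (≡.sym (E≡onLower t)) (≡.sym (subdiag≡sum t)) ⟩
  (E R n t x + x * ∑1) - ((1# + 1#) * x) * subdiag R n t x
    ≈⟨ +-congʳ (+-congˡ (x*∑1≈times R n x)) ⟩
  (E R n t x + times R n x) - ((1# + 1#) * x) * subdiag R n t x ∎
  where
  open CommutativeRing R
  open Graph R n
  open Diffusion R n x
  open import Algebra.Properties.Semiring.Sum semiring using (sum)
  open import Relation.Binary.Reasoning.Setoid setoid
  P : ℕ → VertexFunction
  P = p R n x
  ∑1 : Carrier
  ∑1 = sum {n} (λ _ → 1#)
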